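{- Let $n\geq 2$ be an integer and let $M$ be an $n$-connected binary matroid with $|E(M)|\geq 2n-2$. Suppose $T\subset E(M)$ with $|T|=n-1$. If $M'_T$ is $n$-connected, then $|Q|\geq 2|Q\cap T|$ for every cocircuit $Q$ of $M$ with $Q\cap T\neq\emptyset$.
   Context: Element splitting: let $M$ be a binary matroid with standard matrix representation $A$ over $GF(2)$ and $T\subseteq E(M)$. Let $A'_T$ be the matrix obtained from $A$ by adjoining an extra row whose entries are $1$ in the columns labelled by elements of $T$ and $0$ otherwise, and then adjoining an extra column labelled by a new element $a$ with $1$ in the last row and $0$ elsewhere. $M'_T$ denotes the vector matroid of $A'_T$. A matroid is $n$-connected if it has no $k$-separation for any $k<n$, where a $k$-separation of a matroid $N$ with rank function $r$ is a partition $(X,Y)$ of $E(N)$ with $\min\{|X|,|Y|\}\geq k$ and $r(X)+r(Y)-r(E(N))\leq k-1$. -}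

module Defs where

open import Data.Nat using (ℕ; zero; suc; _+_; _∸_; _≤_; _<_; _⊔_)
open import Data.Bool using (Bool; true; false; _∧_; _∨_; not; _xor_)
open import Data.Vec using (Vec; []; _∷_; map; zipWith; foldr)
open import Data.List as List using (List)
open import Data.Fin using (Fin; zero; suc)
open import Data.Fin.Subset using (Subset; ∣_∣; ∁; ⊤; _∪_; ⁅_⁆; _∉_)
open import Data.Product using (_×_)
open import Relation.Binary.PropositionalEquality using (_≡_)
open import Relation.Nullary using (¬_)

-- A binary matrix with m rows and k columns over GF(2) = Bool (xor, ∧).
-- Columns (Fin k) are the ground set E(M) of the vector matroid M[A].
Matrix : ℕ → ℕ → Set
Matrix m k = Vec (Vec Bool k) m

orV : ∀ {k} → Vec Bool k → Bool
orV = foldr _ _∨_ false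

andV : ∀ {k} → Vec Bool k → Bool
andV = foldr _ _∧_ true

parity : ∀ {k} → Vec Bool k → Bool
parity = foldr _ _xor_ false

subsets : (k : ℕ) → List (Subset k)
subsets zero = [] List.∷ List.[]
subsets (suc k) = List.map (true ∷_) (subsets k) List.++ List.map (false ∷_) (subsets k)

subsetB : ∀ {k} → Subset k → Subset k → Bool
subsetB U S = andV (zipWith (λ u s → not u ∨ s) U S)

-- sum over GF(2) of the columns of A indexed by U
colSum : ∀ {m k} → Matrix m k → Subset k → Vec Bool m
colSum A U = map (λ row → parity (zipWith _∧_ row U)) A

-- S is linearly independent over GF(2): no nonempty U ⊆ S has zero column sum
indepB : ∀ {m k} → Matrix m k → Subset k → Bool
indepB {k = k} A S =
  List.foldr _∧_ true
    (List.map (λ U → not (subsetB U S ∧ orV U) ∨ orV (colSum A U)) (subsets k))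

rank : ∀ {m k} → Matrix m k → Subset k → ℕ
rank {k = k} A X =
  List.foldr _⊔_ 0
    (List.map ∣_∣ (List.filterᵇ (λ S → subsetB S X ∧ indepB A S) (subsets k)))

IsSeparation : ∀ {m k} → Matrix m k → ℕ → Subset k → Set
IsSeparation A j X =
  (j ≤ ∣ X ∣) × (j ≤ ∣ ∁ X ∣) × (rank A X + rank A (∁ X) ≤ rank A ⊤ + (j ∸ 1))

NConnected : ∀ {m k} → ℕ → Matrix m k → Set
NConnected n A = ∀ j X → 1 ≤ j → j < n → ¬ IsSeparation A j X

-- hyperplane: a flat of rank r(M) - 1
IsHyperplane : ∀ {m k} → Matrix m k → Subset k → Set
IsHyperplane A H =
  (suc (rank A H) ≡ rank A ⊤) × (∀ e → e ∉ H → rank A (H ∪ ⁅ e ⁆) ≡ rank A ⊤)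

IsCocircuit : ∀ {m k} → Matrix m k → Subset k → Set
IsCocircuit A Q = IsHyperplane A (∁ Q)

-- element splitting matrix A'_T: new row (indicator of T) placed first,
-- new element a = column zero (1 in the new row, 0 elsewhere);
-- old element j is column suc j.
splitMatrix : ∀ {m k} → Matrix m k → Subset k → Matrix (suc m) (suc k)
splitMatrix A T = (true ∷ T) ∷ map (false ∷_) A

module Submission where

-- Let Q be a cocircuit of the
-- binary matroid M = M[A] and D = Q ⊕ T the symmetric difference with T.  In
-- M'_T the new element a is not spanned by E(M) − D: on E(M) − D the new row
-- (the indicator of T) agrees with the indicator of Q, and the indicator of a
-- cocircuit is orthogonal to every cycle of a binary matroid.  Hence
-- r({a} ∪ D) + r(E − D) ≤ (|D| + 1) + (r(M'_T) − 1), so {a} ∪ D is a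
-- (|D|+1)-separation as soon as both sides are large enough.  If
-- 2|Q ∩ T| > |Q|, then |D| = |Q| + |T| − 2|Q ∩ T| < |T| = n − 1, giving a
-- separation of order below n and contradicting n-connectivity of M'_T.

open import Defs
open import Data.Nat using (ℕ; zero; suc; _≤_; _<_; _+_; _*_; _∸_; _⊔_; z≤n; s≤s; _≤?_)
open import Data.Nat.Properties as ℕ using (≤-refl; ≤-trans)
import Data.Nat.Tactic.RingSolver as Solver
open import Data.Bool as Bool using (Bool; true; false; _∧_; _∨_; not; _xor_; T)
open import Data.Bool.Properties
  using (xor-assoc; xor-comm; xor-same; xor-identityʳ; ∧-zeroʳ; ∧-distribˡ-xor; T-∧;
         xor-∧-commutativeRing)
open import Algebra.Bundles using (CommutativeRing)
open import Algebra.Properties.CommutativeSemigroup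
  (CommutativeRing.+-commutativeSemigroup xor-∧-commutativeRing)
  using () renaming (interchange to xor-interchange)
open import Data.Unit using (tt)
open import Data.Empty using (⊥-elim)
open import Data.Product using (_×_; _,_; proj₁; proj₂; ∃)
open import Data.Sum using (_⊎_; inj₁; inj₂; [_,_]′)
open import Data.Vec using (Vec; []; _∷_; zipWith; lookup; replicate)
open import Data.Vec.Base using (here; there)
open import Data.Vec.Properties
  using (lookup-zipWith; []=⇒lookup; lookup⇒[]=; ≡-dec; map-∘; ∷-injective)
open import Data.Vec.Relation.Binary.Pointwise.Inductive
  using (Pointwise-≡⇒≡; zipWith-assoc; zipWith-comm; zipWith-identityʳ)
open import Data.List as List using (List)
open import Data.List.Membership.Propositional using () renaming (_∈_ to _∈ˡ_)
open import Data.List.Membership.Propositional.Properties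
  using (∈-++⁺ˡ; ∈-++⁺ʳ; ∈-map⁺; ∈-map∘filter⁺; ∈-map∘filter⁻)
open import Data.List.Relation.Unary.Any using (here; there)
import Data.List.Relation.Unary.All as All
open import Data.List.Relation.Unary.All.Properties using (all⁺; all⁻)
open import Data.Fin using (Fin; zero; suc)
open import Data.Fin.Properties using (any?) renaming (_≟_ to _≟ᶠ_)
open import Data.Fin.Subset
  using (Subset; ∣_∣; ∁; ⊤; ⊥; _∩_; _∪_; ⁅_⁆; _∈_; _∉_; _⊆_; _⊂_; Nonempty)
open import Data.Fin.Subset.Properties
  using (nonempty?; Empty-unique; _∈?_; _⊆?_; anySubset?; x∈⁅x⁆; x∈⁅y⁆⇒x≡y; ∉⊥;
         x∈p∩q⁺; x∈p∩q⁻; x∈p∪q⁻; x∉p⇒x∈∁p; x∈∁p⇒x∉p; x∈p⇒x∉∁p;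
         p⊆q⇒∣p∣≤∣q∣; drop-∷-⊆; out⊆; ⊆⊤; ∣⊥∣≡0; ∣∁p∣≡n∸∣p∣)
open import Data.Fin.Subset.Induction using (⊂-wellFounded)
open import Induction.WellFounded using () renaming (module All to WF)
import Relation.Binary.Construct.On as On
open import Function using (_∘′_; id)
open import Function.Bundles using (Equivalence)
open import Relation.Binary.PropositionalEquality
open import Relation.Nullary using (¬_; Dec; yes; no; contradiction)
open import Relation.Nullary.Decidable using (¬?; _×-dec_; T?)

private
  variable
    n : ℕ

infixl 6 _⊕_

_⊕_ : Vec Bool n → Vec Bool n → Vec Bool n
_⊕_ = zipWith _xor_

zeros : Vec Bool n
zeros = replicate _ false

⊕-assoc : (u v w : Vec Bool n) → (u ⊕ v) ⊕ w ≡ u ⊕ (v ⊕ w)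
⊕-assoc u v w = Pointwise-≡⇒≡ (zipWith-assoc xor-assoc u v w)

⊕-comm : (u v : Vec Bool n) → u ⊕ v ≡ v ⊕ u
⊕-comm u v = Pointwise-≡⇒≡ (zipWith-comm xor-comm u v)

⊕-identityʳ : (u : Vec Bool n) → u ⊕ zeros ≡ u
⊕-identityʳ u = Pointwise-≡⇒≡ (zipWith-identityʳ xor-identityʳ u)

⊕-identityˡ : (u : Vec Bool n) → zeros ⊕ u ≡ u
⊕-identityˡ u = trans (⊕-comm zeros u) (⊕-identityʳ u)

⊕-self : (u : Vec Bool n) → u ⊕ u ≡ zeros
⊕-self []      = refl
⊕-self (a ∷ u) = cong₂ _∷_ (xor-same a) (⊕-self u)

⊕-cancelʳ : (u v : Vec Bool n) → (u ⊕ v) ⊕ v ≡ u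
⊕-cancelʳ u v = begin
  (u ⊕ v) ⊕ v   ≡⟨ ⊕-assoc u v v ⟩
  u ⊕ (v ⊕ v)   ≡⟨ cong (u ⊕_) (⊕-self v) ⟩
  u ⊕ zeros     ≡⟨ ⊕-identityʳ u ⟩
  u             ∎
  where open ≡-Reasoning

⊕-cancelˡ : (u v : Vec Bool n) → u ⊕ (u ⊕ v) ≡ v
⊕-cancelˡ u v = begin
  u ⊕ (u ⊕ v)   ≡⟨ sym (⊕-assoc u u v) ⟩
  (u ⊕ u) ⊕ v   ≡⟨ cong (_⊕ v) (⊕-self u) ⟩
  zeros ⊕ v     ≡⟨ ⊕-identityˡ v ⟩
  v             ∎
  where open ≡-Reasoning

⊕-interchange : (a b c d : Vec Bool n) → (a ⊕ b) ⊕ (c ⊕ d) ≡ (a ⊕ c) ⊕ (b ⊕ d)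
⊕-interchange a b c d = begin
  (a ⊕ b) ⊕ (c ⊕ d)   ≡⟨ ⊕-assoc a b (c ⊕ d) ⟩
  a ⊕ (b ⊕ (c ⊕ d))   ≡⟨ cong (a ⊕_) (sym (⊕-assoc b c d)) ⟩
  a ⊕ ((b ⊕ c) ⊕ d)   ≡⟨ cong (λ x → a ⊕ (x ⊕ d)) (⊕-comm b c) ⟩
  a ⊕ ((c ⊕ b) ⊕ d)   ≡⟨ cong (a ⊕_) (⊕-assoc c b d) ⟩
  a ⊕ (c ⊕ (b ⊕ d))   ≡⟨ sym (⊕-assoc a c (b ⊕ d)) ⟩
  (a ⊕ c) ⊕ (b ⊕ d)   ∎
  where open ≡-Reasoning

_·_ : Bool → Vec Bool n → Vec Bool n
true  · v = v
false · v = zeros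

·-distribʳ-xor : (b c : Bool) (v : Vec Bool n) → (b xor c) · v ≡ b · v ⊕ c · v
·-distribʳ-xor true  true  v = sym (⊕-self v)
·-distribʳ-xor true  false v = sym (⊕-identityʳ v)
·-distribʳ-xor false c     v = sym (⊕-identityˡ (c · v))

-- Subsets of Fin n are GF(2)-vectors as well; S ⊕ ⁅ x ⁆ toggles x in S.

lookup-false : {p : Subset n} {y : Fin n} → y ∉ p → lookup p y ≡ false
lookup-false {p = p} {y} y∉p with lookup p y in eq
... | true  = contradiction (lookup⇒[]= y p eq) y∉p
... | false = refl

∈-⊕⁻ : {U V : Subset n} {y : Fin n} → y ∈ U ⊕ V → y ∈ U ⊎ y ∈ V
∈-⊕⁻ {U = U} {V} {y} y∈
  with lookup U y in eU | lookup V y in eV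
     | trans (sym (lookup-zipWith _xor_ y U V)) ([]=⇒lookup y∈)
... | true  | _    | _ = inj₁ (lookup⇒[]= y U eU)
... | false | true | _ = inj₂ (lookup⇒[]= y V eV)

∈-⊕⁺ : {U V : Subset n} {y : Fin n} → y ∈ U → y ∉ V → y ∈ U ⊕ V
∈-⊕⁺ {U = U} {V} {y} y∈U y∉V = lookup⇒[]= y (U ⊕ V)
  (trans (lookup-zipWith _xor_ y U V) (cong₂ _xor_ ([]=⇒lookup y∈U) (lookup-false y∉V)))

∉-⊕ : {U V : Subset n} {y : Fin n} → y ∈ U → y ∈ V → y ∉ U ⊕ V
∉-⊕ {U = U} {V} {y} y∈U y∈V y∈U⊕V
  with trans (sym ([]=⇒lookup y∈U⊕V))
             (trans (lookup-zipWith _xor_ y U V) (cong₂ _xor_ ([]=⇒lookup y∈U) ([]=⇒lookup y∈V)))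
... | ()

∈-toggle⁻ : {S : Subset n} {x y : Fin n} → y ∈ S ⊕ ⁅ x ⁆ → y ∈ S ⊎ y ≡ x
∈-toggle⁻ {x = x} y∈ with ∈-⊕⁻ y∈
... | inj₁ y∈S  = inj₁ y∈S
... | inj₂ y∈x = inj₂ (x∈⁅y⁆⇒x≡y x y∈x)

∈-toggle⁺ : {S : Subset n} {x y : Fin n} → y ∈ S → y ≢ x → y ∈ S ⊕ ⁅ x ⁆
∈-toggle⁺ {x = x} y∈S y≢x = ∈-⊕⁺ y∈S (λ y∈x → y≢x (x∈⁅y⁆⇒x≡y x y∈x))

toggle-adds : {S : Subset n} {x : Fin n} → x ∉ S → x ∈ S ⊕ ⁅ x ⁆
toggle-adds {S = S} {x} x∉S = subst (x ∈_) (⊕-comm ⁅ x ⁆ S) (∈-⊕⁺ (x∈⁅x⁆ x) x∉S)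

toggle-removes : {S : Subset n} {x : Fin n} → x ∈ S → x ∉ S ⊕ ⁅ x ⁆
toggle-removes {x = x} x∈S = ∉-⊕ x∈S (x∈⁅x⁆ x)

⊆-toggle : {S W : Subset n} {e : Fin n} → W ⊆ S ⊕ ⁅ e ⁆ →
           (e ∉ W × W ⊆ S) ⊎ (e ∈ W × W ⊕ ⁅ e ⁆ ⊆ S)
⊆-toggle {S = S} {W} {e} W⊆ with e ∈? W
... | no e∉W  = inj₁ (e∉W , W⊆S)
  where
    W⊆S : W ⊆ S
    W⊆S y∈W with ∈-toggle⁻ (W⊆ y∈W)
    ... | inj₁ y∈S = y∈S
    ... | inj₂ refl = contradiction y∈W e∉W
... | yes e∈W = inj₂ (e∈W , W'⊆S)
  where
    W'⊆S : W ⊕ ⁅ e ⁆ ⊆ S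
    W'⊆S y∈W' with ∈-toggle⁻ y∈W'
    ... | inj₂ refl = contradiction y∈W' (toggle-removes e∈W)
    ... | inj₁ y∈W with ∈-toggle⁻ (W⊆ y∈W)
    ...   | inj₁ y∈S = y∈S
    ...   | inj₂ refl = contradiction y∈W' (toggle-removes e∈W)

∣toggle-out∣ : {S : Subset n} {x : Fin n} → x ∉ S → ∣ S ⊕ ⁅ x ⁆ ∣ ≡ suc ∣ S ∣
∣toggle-out∣ {S = true  ∷ S} {zero}  x∉S = contradiction here x∉S
∣toggle-out∣ {S = false ∷ S} {zero}  _   = cong (suc ∘′ ∣_∣) (⊕-identityʳ S)
∣toggle-out∣ {S = true  ∷ S} {suc x} x∉S = cong suc (∣toggle-out∣ (x∉S ∘′ there))
∣toggle-out∣ {S = false ∷ S} {suc x} x∉S = ∣toggle-out∣ (x∉S ∘′ there)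

∣toggle-in∣ : {S : Subset n} {x : Fin n} → x ∈ S → suc ∣ S ⊕ ⁅ x ⁆ ∣ ≡ ∣ S ∣
∣toggle-in∣ {S = true ∷ S} {zero}  here        = cong (suc ∘′ ∣_∣) (⊕-identityʳ S)
∣toggle-in∣ {S = true ∷ S} {suc x} (there x∈S) = cong suc (∣toggle-in∣ x∈S)
∣toggle-in∣ {S = false ∷ S} {suc x} (there x∈S) = ∣toggle-in∣ x∈S

build-up : (P : Subset n → Set) → P ⊥ →
           (∀ S x → x ∉ S → P S → P (S ⊕ ⁅ x ⁆)) → ∀ S → P S
build-up P base step = WF.wfRec ⊂-wellFounded _ P rec
  where
    rec : ∀ S → (∀ {S'} → S' ⊂ S → P S') → P S
    rec S ih with nonempty? S
    ... | no empty = subst P (sym (Empty-unique empty)) base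
    ... | yes (x , x∈S) = subst P (⊕-cancelʳ S ⁅ x ⁆) (step _ x (toggle-removes x∈S) (ih smaller))
      where
        smaller : S ⊕ ⁅ x ⁆ ⊂ S
        smaller = (λ y∈ → [ id , (λ { refl → contradiction y∈ (toggle-removes x∈S) }) ]′
                             (∈-toggle⁻ y∈))
                , x , x∈S , toggle-removes x∈S

dot : Vec Bool n → Vec Bool n → Bool
dot r U = parity (zipWith _∧_ r U)

dot-⊕ʳ : (r U V : Vec Bool n) → dot r (U ⊕ V) ≡ dot r U xor dot r V
dot-⊕ʳ []      []      []      = refl
dot-⊕ʳ (a ∷ r) (u ∷ U) (v ∷ V) = begin
  (a ∧ (u xor v)) xor dot r (U ⊕ V)
    ≡⟨ cong₂ _xor_ (∧-distribˡ-xor a u v) (dot-⊕ʳ r U V) ⟩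
  ((a ∧ u) xor (a ∧ v)) xor (dot r U xor dot r V)
    ≡⟨ xor-interchange (a ∧ u) (a ∧ v) (dot r U) (dot r V) ⟩
  ((a ∧ u) xor dot r U) xor ((a ∧ v) xor dot r V)   ∎
  where open ≡-Reasoning

dot-zerosʳ : (r : Vec Bool n) → dot r zeros ≡ false
dot-zerosʳ []          = refl
dot-zerosʳ (true  ∷ r) = dot-zerosʳ r
dot-zerosʳ (false ∷ r) = dot-zerosʳ r

dot-⁅⁆ : (r : Vec Bool n) (e : Fin n) → dot r ⁅ e ⁆ ≡ lookup r e
dot-⁅⁆ (true  ∷ r) zero    = cong (true xor_) (dot-zerosʳ r)
dot-⁅⁆ (false ∷ r) zero    = dot-zerosʳ r
dot-⁅⁆ (true  ∷ r) (suc e) = dot-⁅⁆ r e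
dot-⁅⁆ (false ∷ r) (suc e) = dot-⁅⁆ r e

dot-true⇒nonempty : (r U : Vec Bool n) → dot r U ≡ true → Nonempty r
dot-true⇒nonempty []          []      ()
dot-true⇒nonempty (true  ∷ r) (u ∷ U) _ = zero , here
dot-true⇒nonempty (false ∷ r) (u ∷ U) h with dot-true⇒nonempty r U h
... | x , x∈r = suc x , there x∈r

Additive : {k m : ℕ} → (Subset k → Vec Bool m) → Set
Additive f = ∀ U V → f (U ⊕ V) ≡ f U ⊕ f V

additive-⊥ : {k m : ℕ} {f : Subset k → Vec Bool m} → Additive f → f ⊥ ≡ zeros
additive-⊥ {f = f} additive = begin
  f ⊥             ≡⟨ cong f (sym (⊕-self ⊥)) ⟩
  f (⊥ ⊕ ⊥)       ≡⟨ additive ⊥ ⊥ ⟩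
  f ⊥ ⊕ f ⊥       ≡⟨ ⊕-self (f ⊥) ⟩
  zeros           ∎
  where open ≡-Reasoning

colSum-additive : {m k : ℕ} (A : Matrix m k) → Additive (colSum A)
colSum-additive []      U V = refl
colSum-additive (r ∷ A) U V = cong₂ _∷_ (dot-⊕ʳ r U V) (colSum-additive A U V)

∈-subsets : ∀ {k} (U : Subset k) → U ∈ˡ subsets k
∈-subsets []          = here refl
∈-subsets (true  ∷ U) = ∈-++⁺ˡ (∈-map⁺ (true ∷_) (∈-subsets U))
∈-subsets {suc k} (false ∷ U) =
  ∈-++⁺ʳ (List.map (true ∷_) (subsets k)) (∈-map⁺ (false ∷_) (∈-subsets U))

⊆⇒subsetB : {U S : Subset n} → U ⊆ S → T (subsetB U S)
⊆⇒subsetB {U = []}        {[]}        _   = tt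
⊆⇒subsetB {U = false ∷ U} {s ∷ S}     U⊆S = ⊆⇒subsetB (drop-∷-⊆ U⊆S)
⊆⇒subsetB {U = true ∷ U}  {true ∷ S}  U⊆S = ⊆⇒subsetB (drop-∷-⊆ U⊆S)
⊆⇒subsetB {U = true ∷ U}  {false ∷ S} U⊆S with U⊆S here
... | ()

subsetB⇒⊆ : {U S : Subset n} → T (subsetB U S) → U ⊆ S
subsetB⇒⊆ {U = true ∷ U} {true ∷ S} _ here = here
subsetB⇒⊆ {U = u ∷ U}    {s ∷ S}    h (there y∈U) =
  there (subsetB⇒⊆ (proj₂ (Equivalence.to (T-∧ {not u ∨ s}) h)) y∈U)

nonempty⇒orV : {U : Subset n} → Nonempty U → T (orV U)
nonempty⇒orV {U = true  ∷ U} _                  = tt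
nonempty⇒orV {U = false ∷ U} (suc x , there x∈U) = nonempty⇒orV (x , x∈U)

orV⇒nonempty : {U : Subset n} → T (orV U) → Nonempty U
orV⇒nonempty {U = true  ∷ U} _ = zero , here
orV⇒nonempty {U = false ∷ U} h with orV⇒nonempty h
... | x , x∈U = suc x , there x∈U

¬orV⇒zeros : {v : Vec Bool n} → ¬ T (orV v) → v ≡ zeros
¬orV⇒zeros {v = []}        _ = refl
¬orV⇒zeros {v = true  ∷ v} h = contradiction tt h
¬orV⇒zeros {v = false ∷ v} h = cong (false ∷_) (¬orV⇒zeros h)

¬orV-zeros : ∀ n → ¬ T (orV (zeros {n}))
¬orV-zeros zero    ()
¬orV-zeros (suc n) = ¬orV-zeros n

-- The clause checked by indepB for each candidate subset U.
implication⁺ : ∀ a b c → (T a → T b → T c) → T (not (a ∧ b) ∨ c)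
implication⁺ true  true  c f = f tt tt
implication⁺ true  false c f = tt
implication⁺ false b     c f = tt

implication⁻ : ∀ a b c → T (not (a ∧ b) ∨ c) → T a → T b → T c
implication⁻ true true c h _ _ = h

≤-listMax : ∀ {x} {xs : List ℕ} → x ∈ˡ xs → x ≤ List.foldr _⊔_ 0 xs
≤-listMax {xs = y List.∷ ys} (here refl)  = ℕ.m≤m⊔n y _
≤-listMax {xs = y List.∷ ys} (there x∈ys) = ≤-trans (≤-listMax x∈ys) (ℕ.m≤n⊔m y _)

listMax-attained : (xs : List ℕ) → List.foldr _⊔_ 0 xs ≡ 0 ⊎ List.foldr _⊔_ 0 xs ∈ˡ xs
listMax-attained List.[] = inj₁ refl
listMax-attained (x List.∷ xs) with ℕ.⊔-sel x (List.foldr _⊔_ 0 xs)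
... | inj₁ max≡x = inj₂ (here max≡x)
... | inj₂ max≡r with listMax-attained xs
...   | inj₁ r≡0  = inj₁ (trans max≡r r≡0)
...   | inj₂ r∈xs = inj₂ (there (subst (_∈ˡ xs) (sym max≡r) r∈xs))

module Linear {m k : ℕ} (A : Matrix m k) where

  col : Fin k → Vec Bool m
  col e = colSum A ⁅ e ⁆

  Indep : Subset k → Set
  Indep S = ∀ U → U ⊆ S → Nonempty U → colSum A U ≢ zeros

  InSpan : Subset k → Vec Bool m → Set
  InSpan S v = ∃ λ W → W ⊆ S × colSum A W ≡ v

  SpannedBy : Subset k → Subset k → Set
  SpannedBy J I = ∀ {y} → y ∈ J → InSpan I (col y)

  span? : ∀ S v → Dec (InSpan S v)
  span? S v = anySubset? (λ W → (W ⊆? S) ×-dec ≡-dec Bool._≟_ (colSum A W) v)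

  span-zeros : ∀ S → InSpan S zeros
  span-zeros S = ⊥ , (λ x∈⊥ → contradiction x∈⊥ ∉⊥) , additive-⊥ (colSum-additive A)

  span-⊕ : ∀ {S u v} → InSpan S u → InSpan S v → InSpan S (u ⊕ v)
  span-⊕ {S} (U , U⊆S , refl) (V , V⊆S , refl) =
    U ⊕ V , [ U⊆S , V⊆S ]′ ∘′ ∈-⊕⁻ , colSum-additive A U V

  span-col : ∀ {S x} → x ∈ S → InSpan S (col x)
  span-col {S} {x} x∈S = ⁅ x ⁆ , (λ y∈ → subst (_∈ S) (sym (x∈⁅y⁆⇒x≡y x y∈)) x∈S) , refl

  additive-span : ∀ {S} {f : Subset k → Vec Bool m} → Additive f →
                  ∀ W → (∀ {x} → x ∈ W → InSpan S (f ⁅ x ⁆)) → InSpan S (f W)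
  additive-span {S} {f} additive W singletons = build-up P base step W id
    where
      P : Subset k → Set
      P V = V ⊆ W → InSpan S (f V)
      base : P ⊥
      base _ = subst (InSpan S) (sym (additive-⊥ additive)) (span-zeros S)
      step : ∀ V x → x ∉ V → P V → P (V ⊕ ⁅ x ⁆)
      step V x x∉V ih V'⊆W =
        subst (InSpan S) (sym (additive V ⁅ x ⁆))
          (span-⊕ (ih (λ y∈V → V'⊆W (∈-toggle⁺ y∈V (λ { refl → x∉V y∈V }))))
                  (singletons (V'⊆W (toggle-adds x∉V))))

  span-trans : ∀ {S S' v} → SpannedBy S S' → InSpan S v → InSpan S' v
  span-trans cols (W , W⊆S , refl) = additive-span (colSum-additive A) W (cols ∘′ W⊆S)

  colSum-untoggle : ∀ W i → colSum A W ≡ colSum A (W ⊕ ⁅ i ⁆) ⊕ col i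
  colSum-untoggle W i =
    trans (cong (colSum A) (sym (⊕-cancelʳ W ⁅ i ⁆))) (colSum-additive A (W ⊕ ⁅ i ⁆) ⁅ i ⁆)

  span-toggle : ∀ {S e v} → InSpan (S ⊕ ⁅ e ⁆) v → InSpan S v ⊎ InSpan S (v ⊕ col e)
  span-toggle {e = e} (W , W⊆ , refl) with ⊆-toggle W⊆
  ... | inj₁ (_ , W⊆S)  = inj₁ (W , W⊆S , refl)
  ... | inj₂ (_ , W'⊆S) = inj₂ (W ⊕ ⁅ e ⁆ , W'⊆S , colSum-additive A W ⁅ e ⁆)

  extend : ∀ {I e} → Indep I → ¬ InSpan I (col e) → Indep (I ⊕ ⁅ e ⁆)
  extend {I} {e} indI e∉span U U⊆ U≠∅ U≡0 with ⊆-toggle U⊆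
  ... | inj₁ (_ , U⊆I)  = indI U U⊆I U≠∅ U≡0
  ... | inj₂ (_ , U'⊆I) = e∉span (U ⊕ ⁅ e ⁆ , U'⊆I , col-e)
    where
      col-e : colSum A (U ⊕ ⁅ e ⁆) ≡ col e
      col-e = begin
        colSum A (U ⊕ ⁅ e ⁆)   ≡⟨ colSum-additive A U ⁅ e ⁆ ⟩
        colSum A U ⊕ col e     ≡⟨ cong (_⊕ col e) U≡0 ⟩
        zeros ⊕ col e          ≡⟨ ⊕-identityˡ (col e) ⟩
        col e                  ∎
        where open ≡-Reasoning

  -- A representation col j = colSum A W with j ∉ W of a column of an
  -- independent set J must leave J: otherwise W ⊕ ⁅ j ⁆ ⊆ J sums to zero.
  leaves-independent : ∀ {J W j} → Indep J → j ∈ J → j ∉ W → colSum A W ≡ col j →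
                       ∃ λ i → i ∈ W × i ∉ J
  leaves-independent {J} {W} {j} indJ j∈J j∉W W≡j
    with any? (λ i → (i ∈? W) ×-dec ¬? (i ∈? J))
  ... | yes found = found
  ... | no none   = contradiction W⊕j≡0 (indJ (W ⊕ ⁅ j ⁆) W⊕j⊆J (j , toggle-adds j∉W))
    where
      W⊆J : W ⊆ J
      W⊆J {y} y∈W with y ∈? J
      ... | yes y∈J = y∈J
      ... | no  y∉J = contradiction (y , y∈W , y∉J) none
      W⊕j⊆J : W ⊕ ⁅ j ⁆ ⊆ J
      W⊕j⊆J y∈ = [ W⊆J , (λ { refl → j∈J }) ]′ (∈-toggle⁻ y∈)
      W⊕j≡0 : colSum A (W ⊕ ⁅ j ⁆) ≡ zeros
      W⊕j≡0 = trans (colSum-additive A W ⁅ j ⁆) (trans (cong (_⊕ col j) W≡j) (⊕-self (col j)))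

  exchange : ∀ {J I j} → Indep J → SpannedBy J I → j ∈ J → j ∉ I →
             ∃ λ I' → ∣ I' ∣ ≡ ∣ I ∣ × SpannedBy J I' × J ∩ ∁ I' ⊂ J ∩ ∁ I
  exchange {J} {I} {j} indJ J⊆span j∈J j∉I with J⊆span j∈J
  ... | W , W⊆I , W≡j with leaves-independent indJ j∈J (j∉I ∘′ W⊆I) W≡j
  ... | i , i∈W , i∉J = I' , size , span-trans I⊆span ∘′ J⊆span , shrink
    where
      I₀ I' : Subset k
      I₀ = I ⊕ ⁅ i ⁆
      I' = I₀ ⊕ ⁅ j ⁆

      j∉I₀ : j ∉ I₀
      j∉I₀ j∈I₀ = [ j∉I , (λ { refl → i∉J j∈J }) ]′ (∈-toggle⁻ j∈I₀)

      j∈I' : j ∈ I'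
      j∈I' = toggle-adds j∉I₀

      keep : ∀ {y} → y ∈ I → y ≢ i → y ∈ I'
      keep y∈I y≢i = ∈-toggle⁺ (∈-toggle⁺ y∈I y≢i) (λ { refl → j∉I y∈I })

      size : ∣ I' ∣ ≡ ∣ I ∣
      size = trans (∣toggle-out∣ j∉I₀) (∣toggle-in∣ (W⊆I i∈W))

      -- col i = colSum (W ⊕ ⁅ i ⁆) ⊕ col j, and W ⊕ ⁅ i ⁆ ⊆ I'.
      i-spanned : InSpan I' (col i)
      i-spanned = subst (InSpan I') col-i (span-⊕ (W' , W'⊆I' , refl) (span-col j∈I'))
        where
          W' : Subset k
          W' = W ⊕ ⁅ i ⁆
          W'⊆I' : W' ⊆ I'
          W'⊆I' y∈W' with ∈-toggle⁻ y∈W'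
          ... | inj₁ y∈W = keep (W⊆I y∈W) (λ { refl → toggle-removes i∈W y∈W' })
          ... | inj₂ refl = contradiction y∈W' (toggle-removes i∈W)
          col-i : colSum A W' ⊕ col j ≡ col i
          col-i = begin
            colSum A W' ⊕ col j                   ≡⟨ cong (colSum A W' ⊕_) (sym W≡j) ⟩
            colSum A W' ⊕ colSum A W              ≡⟨ cong (colSum A W' ⊕_) (colSum-untoggle W i) ⟩
            colSum A W' ⊕ (colSum A W' ⊕ col i)   ≡⟨ ⊕-cancelˡ (colSum A W') (col i) ⟩
            col i                                 ∎
            where open ≡-Reasoning

      I⊆span : SpannedBy I I'
      I⊆span {y} y∈I with y ≟ᶠ i
      ... | yes refl = i-spanned
      ... | no  y≢i  = span-col (keep y∈I y≢i)

      shrink : J ∩ ∁ I' ⊂ J ∩ ∁ I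
      shrink = smaller , j , x∈p∩q⁺ (j∈J , x∉p⇒x∈∁p j∉I) , j-gone
        where
          smaller : J ∩ ∁ I' ⊆ J ∩ ∁ I
          smaller {y} y∈ with x∈p∩q⁻ J (∁ I') y∈
          ... | y∈J , y∈∁I' = x∈p∩q⁺ (y∈J , x∉p⇒x∈∁p
                  (λ y∈I → x∈∁p⇒x∉p y∈∁I' (keep y∈I (λ { refl → i∉J y∈J }))))
          j-gone : j ∉ J ∩ ∁ I'
          j-gone j∈ = x∈∁p⇒x∉p (proj₂ (x∈p∩q⁻ J (∁ I') j∈)) j∈I'

  steinitz : ∀ {J} → Indep J → ∀ I → SpannedBy J I → ∣ J ∣ ≤ ∣ I ∣
  steinitz {J} indJ = WF.wfRec (On.wellFounded (λ I → J ∩ ∁ I) ⊂-wellFounded) _ P rec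
    where
      P : Subset k → Set
      P I = SpannedBy J I → ∣ J ∣ ≤ ∣ I ∣
      rec : ∀ I → (∀ {I'} → J ∩ ∁ I' ⊂ J ∩ ∁ I → P I') → P I
      rec I ih J⊆span with nonempty? (J ∩ ∁ I)
      ... | yes (j , j∈) with x∈p∩q⁻ J (∁ I) j∈
      ...   | j∈J , j∈∁I with exchange indJ J⊆span j∈J (x∈∁p⇒x∉p j∈∁I)
      ...     | I' , size , J⊆span' , shrink = subst (∣ J ∣ ≤_) size (ih shrink J⊆span')
      rec I ih J⊆span | no J∖I-empty = p⊆q⇒∣p∣≤∣q∣ J⊆I
        where
          J⊆I : J ⊆ I
          J⊆I {y} y∈J with y ∈? I
          ... | yes y∈I = y∈I
          ... | no  y∉I = contradiction (y , x∈p∩q⁺ (y∈J , x∉p⇒x∈∁p y∉I)) J∖I-empty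

  indepB-sound : ∀ S → T (indepB A S) → Indep S
  indepB-sound S h U U⊆S U≠∅ U≡0 =
    ¬orV-zeros m (subst (T ∘′ orV) U≡0
      (implication⁻ _ _ _ (All.lookup (all⁺ _ (subsets k) h) (∈-subsets U))
                    (⊆⇒subsetB U⊆S) (nonempty⇒orV U≠∅)))

  indepB-complete : ∀ S → Indep S → T (indepB A S)
  indepB-complete S indS =
    all⁻ _ {xs = subsets k} (All.tabulate (λ {U} _ → implication⁺ _ _ _ (nonzero U)))
    where
      nonzero : ∀ U → T (subsetB U S) → T (orV U) → T (orV (colSum A U))
      nonzero U U⊆S U≠∅ with T? (orV (colSum A U))
      ... | yes ≠0 = ≠0
      ... | no  =0 = contradiction (¬orV⇒zeros =0) (indS U (subsetB⇒⊆ U⊆S) (orV⇒nonempty U≠∅))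

  IsBasis : Subset k → Subset k → Set
  IsBasis X I = I ⊆ X × Indep I × ∣ I ∣ ≡ rank A X

  private
    candidate : Subset k → Subset k → Bool
    candidate X S = subsetB S X ∧ indepB A S

  rank-ge : ∀ {S X} → S ⊆ X → Indep S → ∣ S ∣ ≤ rank A X
  rank-ge {S} {X} S⊆X indS =
    ≤-listMax (∈-map∘filter⁺ ∣_∣ {P = T ∘′ candidate X} (λ S → T? (candidate X S))
      (S , ∈-subsets S , refl , Equivalence.from T-∧ (⊆⇒subsetB S⊆X , indepB-complete S indS)))

  basis-exists : ∀ X → ∃ (IsBasis X)
  basis-exists X with listMax-attained (List.map ∣_∣ (List.filterᵇ (candidate X) (subsets k)))
  ... | inj₁ rank≡0 = ⊥ , (λ x∈⊥ → contradiction x∈⊥ ∉⊥) , (λ U U⊆⊥ (x , x∈U) _ → ∉⊥ (U⊆⊥ x∈U)) ,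
                      trans (∣⊥∣≡0 k) (sym rank≡0)
  ... | inj₂ rank∈
    with ∈-map∘filter⁻ ∣_∣ {P = T ∘′ candidate X} (λ S → T? (candidate X S)) {xs = subsets k} rank∈
  ...   | I , _ , rank≡∣I∣ , isCandidate with Equivalence.to (T-∧ {subsetB I X}) isCandidate
  ...     | I⊆X , indI = I , subsetB⇒⊆ I⊆X , indepB-sound I indI , sym rank≡∣I∣

  rank-le : ∀ X → rank A X ≤ ∣ X ∣
  rank-le X with basis-exists X
  ... | I , I⊆X , _ , ∣I∣≡rank = subst (_≤ ∣ X ∣) ∣I∣≡rank (p⊆q⇒∣p∣≤∣q∣ I⊆X)

  -- A basis of X spans every column of X: otherwise it could be extended
  -- inside X beyond rank A X.
  basis-spans : ∀ {X I} → IsBasis X I → SpannedBy X I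
  basis-spans {X} {I} (I⊆X , indI , ∣I∣≡rank) {x} x∈X with span? I (col x)
  ... | yes spanned = spanned
  ... | no  x∉span  = ⊥-elim (ℕ.<-irrefl refl (begin-strict
        ∣ I ∣                 <⟨ ℕ.n<1+n ∣ I ∣ ⟩
        suc ∣ I ∣             ≡⟨ sym (∣toggle-out∣ x∉I) ⟩
        ∣ I ⊕ ⁅ x ⁆ ∣         ≤⟨ rank-ge I'⊆X (extend indI x∉span) ⟩
        rank A X              ≡⟨ sym ∣I∣≡rank ⟩
        ∣ I ∣                 ∎))
    where
      open ℕ.≤-Reasoning
      x∉I : x ∉ I
      x∉I x∈I = x∉span (span-col x∈I)
      I'⊆X : I ⊕ ⁅ x ⁆ ⊆ X
      I'⊆X y∈ = [ I⊆X , (λ { refl → x∈X }) ]′ (∈-toggle⁻ y∈)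

-- Orthogonality of cocircuits and cycles: in the binary matroid M[A] a
-- cocircuit Q meets every set of columns with zero sum evenly.  Let I be a
-- basis of the hyperplane H = ∁ Q.  Columns in H are spanned by I, columns
-- in Q are not, and for a fixed e₁ ∈ Q the set I ⊕ ⁅ e₁ ⁆ is a basis of M[A].
-- Hence col x ⊕ [x ∈ Q]·col e₁ ∈ span I for every x, and by additivity
-- colSum A U ⊕ dot Q U · col e₁ ∈ span I for every U; for a zero-sum U with
-- dot Q U odd this would put col e₁ in span I.
module Cocircuit {m k : ℕ} (A : Matrix m k) (Q : Subset k) (cocircuit : IsCocircuit A Q) where
  open Linear A

  H : Subset k
  H = ∁ Q

  private
    basisH : ∃ (IsBasis H)
    basisH = basis-exists H

  I : Subset k
  I = proj₁ basisH

  I-basis : IsBasis H I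
  I-basis = proj₂ basisH

  rank-⊤ : rank A ⊤ ≡ suc ∣ I ∣
  rank-⊤ = trans (sym (proj₁ cocircuit)) (cong suc (sym (proj₂ (proj₂ I-basis))))

  -- Otherwise the full-rank set H ∪ ⁅ e ⁆ would be spanned by I (Steinitz).
  outside-unspanned : ∀ {e} → e ∈ Q → ¬ InSpan I (col e)
  outside-unspanned {e} e∈Q e-spanned with basis-exists (H ∪ ⁅ e ⁆)
  ... | J , J⊆ , indJ , ∣J∣≡rank = ℕ.<-irrefl refl (begin-strict
        ∣ I ∣                   <⟨ ℕ.n<1+n ∣ I ∣ ⟩
        suc ∣ I ∣               ≡⟨ sym rank-⊤ ⟩
        rank A ⊤                ≡⟨ sym (proj₂ cocircuit e (x∈p⇒x∉∁p e∈Q)) ⟩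
        rank A (H ∪ ⁅ e ⁆)      ≡⟨ sym ∣J∣≡rank ⟩
        ∣ J ∣                   ≤⟨ steinitz indJ I J-spanned ⟩
        ∣ I ∣                   ∎)
    where
      open ℕ.≤-Reasoning
      J-spanned : SpannedBy J I
      J-spanned j∈J with x∈p∪q⁻ H ⁅ e ⁆ (J⊆ j∈J)
      ... | inj₁ j∈H = basis-spans I-basis j∈H
      ... | inj₂ j∈e = subst (InSpan I ∘′ col) (sym (x∈⁅y⁆⇒x≡y e j∈e)) e-spanned

  module Shifted {e₁ : Fin k} (e₁∈Q : e₁ ∈ Q) where

    shifted : Subset k → Vec Bool m
    shifted U = colSum A U ⊕ dot Q U · col e₁

    shifted-additive : Additive shifted
    shifted-additive U V = begin
      colSum A (U ⊕ V) ⊕ dot Q (U ⊕ V) · col e₁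
        ≡⟨ cong₂ _⊕_ (colSum-additive A U V) (cong (_· col e₁) (dot-⊕ʳ Q U V)) ⟩
      (colSum A U ⊕ colSum A V) ⊕ (dot Q U xor dot Q V) · col e₁
        ≡⟨ cong ((colSum A U ⊕ colSum A V) ⊕_) (·-distribʳ-xor (dot Q U) (dot Q V) (col e₁)) ⟩
      (colSum A U ⊕ colSum A V) ⊕ (dot Q U · col e₁ ⊕ dot Q V · col e₁)
        ≡⟨ ⊕-interchange (colSum A U) (colSum A V) (dot Q U · col e₁) (dot Q V · col e₁) ⟩
      shifted U ⊕ shifted V   ∎
      where open ≡-Reasoning

    full-basis : IsBasis ⊤ (I ⊕ ⁅ e₁ ⁆)
    full-basis = ⊆⊤ , extend indI (outside-unspanned e₁∈Q) ,
                 trans (∣toggle-out∣ e₁∉I) (sym rank-⊤)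
      where
        indI : Indep I
        indI = proj₁ (proj₂ I-basis)
        e₁∉I : e₁ ∉ I
        e₁∉I e₁∈I = x∈p⇒x∉∁p e₁∈Q (proj₁ I-basis e₁∈I)

    shifted-column : ∀ x → InSpan I (shifted ⁅ x ⁆)
    shifted-column x
      rewrite dot-⁅⁆ Q x with x ∈? Q
    ... | no x∉Q rewrite lookup-false x∉Q =
      subst (InSpan I) (sym (⊕-identityʳ (col x))) (basis-spans I-basis (x∉p⇒x∈∁p x∉Q))
    ... | yes x∈Q rewrite []=⇒lookup x∈Q with span-toggle (basis-spans full-basis (⊆⊤ x∈Q))
    ...   | inj₁ x-spanned = contradiction x-spanned (outside-unspanned x∈Q)
    ...   | inj₂ shifted-x = shifted-x

    shifted-spanned : ∀ U → InSpan I (shifted U)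
    shifted-spanned U = additive-span shifted-additive U (λ {x} _ → shifted-column x)

  cycle-even : ∀ U → colSum A U ≡ zeros → dot Q U ≡ false
  cycle-even U U≡0 with dot Q U in odd
  ... | false = refl
  ... | true with dot-true⇒nonempty Q U odd
  ...   | e₁ , e₁∈Q = contradiction (subst (InSpan I) collapse (shifted-spanned U))
                                    (outside-unspanned e₁∈Q)
    where
      open Shifted e₁∈Q
      collapse : shifted U ≡ col e₁
      collapse = begin
        colSum A U ⊕ dot Q U · col e₁   ≡⟨ cong₂ _⊕_ U≡0 (cong (_· col e₁) odd) ⟩
        zeros ⊕ col e₁                  ≡⟨ ⊕-identityˡ (col e₁) ⟩
        col e₁                          ∎
        where open ≡-Reasoning

dot-agree : (Q T U : Subset n) → U ⊆ ∁ (Q ⊕ T) → dot T U ≡ dot Q U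
dot-agree []      []      []          _   = refl
dot-agree (q ∷ Q) (t ∷ T) (false ∷ U) U⊆ =
  cong₂ _xor_ (trans (∧-zeroʳ t) (sym (∧-zeroʳ q))) (dot-agree Q T U (drop-∷-⊆ U⊆))
dot-agree (q ∷ Q) (t ∷ T) (true ∷ U)  U⊆ =
  cong₂ _xor_ (same-bit q t (U⊆ here)) (dot-agree Q T U (drop-∷-⊆ U⊆))
  where
    same-bit : ∀ q t → zero ∈ ∁ ((q ∷ Q) ⊕ (t ∷ T)) → t ∧ true ≡ q ∧ true
    same-bit true  true  _ = refl
    same-bit false false _ = refl

∣⊕∣+2∣∩∣ : (Q T : Subset n) → ∣ Q ⊕ T ∣ + 2 * ∣ Q ∩ T ∣ ≡ ∣ Q ∣ + ∣ T ∣
∣⊕∣+2∣∩∣ []          []          = refl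
∣⊕∣+2∣∩∣ (true  ∷ Q) (true  ∷ T) = begin
  ∣ Q ⊕ T ∣ + 2 * suc ∣ Q ∩ T ∣     ≡⟨ solve-∀ ∣ Q ⊕ T ∣ ∣ Q ∩ T ∣ ⟩
  2 + (∣ Q ⊕ T ∣ + 2 * ∣ Q ∩ T ∣)   ≡⟨ cong (2 +_) (∣⊕∣+2∣∩∣ Q T) ⟩
  2 + (∣ Q ∣ + ∣ T ∣)               ≡⟨ cong suc (sym (ℕ.+-suc ∣ Q ∣ ∣ T ∣)) ⟩
  suc ∣ Q ∣ + suc ∣ T ∣             ∎
  where
    open ≡-Reasoning
    solve-∀ : ∀ d c → d + 2 * suc c ≡ 2 + (d + 2 * c)
    solve-∀ = Solver.solve-∀
∣⊕∣+2∣∩∣ (true  ∷ Q) (false ∷ T) = cong suc (∣⊕∣+2∣∩∣ Q T)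
∣⊕∣+2∣∩∣ (false ∷ Q) (true  ∷ T) = trans (cong suc (∣⊕∣+2∣∩∣ Q T)) (sym (ℕ.+-suc ∣ Q ∣ ∣ T ∣))
∣⊕∣+2∣∩∣ (false ∷ Q) (false ∷ T) = ∣⊕∣+2∣∩∣ Q T

colSum-split : ∀ {m k} (A : Matrix m k) (T : Subset k) u U →
               colSum (splitMatrix A T) (u ∷ U) ≡ (u xor dot T U) ∷ colSum A U
colSum-split A T u U = cong (_ ∷_) (sym (map-∘ _ _ A))

-- For a cocircuit Q of M[A], the new element a of M'_T together with
-- D = Q ⊕ T is a (|D|+1)-separation of M'_T whenever its complement is
-- large enough: a is not spanned by the old elements outside D, since on
-- them the new row agrees with the indicator of Q, which is orthogonal to
-- every cycle of M[A].
module Splitting {m k : ℕ} (A : Matrix m k) (T Q : Subset k) (cocircuit : IsCocircuit A Q) where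
  open Linear (splitMatrix A T)
  open Cocircuit A Q cocircuit using (cycle-even)

  D : Subset k
  D = Q ⊕ T

  -- The new element a joins any independent set I of old elements avoiding
  -- D: a zero-sum set a ∪ U would make U a cycle of M[A] avoiding D with
  -- dot T U odd, whereas dot T U = dot Q U is even.
  add-new-element : ∀ I → I ⊆ ∁ D → Indep (false ∷ I) → Indep (true ∷ I)
  add-new-element I I⊆ indI (false ∷ U) U⊆ U≠∅ U≡0 =
    indI (false ∷ U) (out⊆ (drop-∷-⊆ U⊆)) U≠∅ U≡0
  add-new-element I I⊆ indI (true ∷ U) U⊆ _ U≡0
    with ∷-injective (trans (sym (colSum-split A T true U)) U≡0)
  ... | new-row-odd , cycle = contradiction true≡false λ ()
    where
      T-even : dot T U ≡ false
      T-even = trans (dot-agree Q T U (I⊆ ∘′ drop-∷-⊆ U⊆)) (cycle-even U cycle)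
      true≡false : true ≡ false
      true≡false = trans (cong not (sym T-even)) new-row-odd

  -- Hence a basis of the old elements outside D extends by a.
  rank-gap : suc (rank (splitMatrix A T) (∁ (true ∷ D))) ≤ rank (splitMatrix A T) ⊤
  rank-gap with basis-exists (∁ (true ∷ D))
  ... | true ∷ I , I⊆ , _ , _ with I⊆ here
  ...   | ()
  rank-gap | false ∷ I , I⊆ , indI , ∣I∣≡rank =
    subst (λ r → suc r ≤ _) ∣I∣≡rank (rank-ge ⊆⊤ (add-new-element I (drop-∷-⊆ I⊆) indI))

  -- r({a} ∪ D) ≤ |D| + 1 and r(E − D) < r(M'_T).
  separation : suc ∣ D ∣ ≤ ∣ ∁ D ∣ → IsSeparation (splitMatrix A T) (suc ∣ D ∣) (true ∷ D)
  separation room = ≤-refl , room , ranks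
    where
      open ℕ.≤-Reasoning
      r = rank (splitMatrix A T)
      ranks : r (true ∷ D) + r (∁ (true ∷ D)) ≤ r ⊤ + ∣ D ∣
      ranks = begin
        r (true ∷ D) + r (∁ (true ∷ D))     ≤⟨ ℕ.+-monoˡ-≤ _ (rank-le (true ∷ D)) ⟩
        suc ∣ D ∣ + r (∁ (true ∷ D))        ≡⟨ sym (ℕ.+-suc ∣ D ∣ _) ⟩
        ∣ D ∣ + suc (r (∁ (true ∷ D)))      ≤⟨ ℕ.+-monoʳ-≤ ∣ D ∣ rank-gap ⟩
        ∣ D ∣ + r ⊤                         ≡⟨ ℕ.+-comm ∣ D ∣ (r ⊤) ⟩
        r ⊤ + ∣ D ∣                         ∎

overlap-shrinks : ∀ {d x q t} → d + x ≡ q + t → q < x → d < t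
overlap-shrinks {d} {x} {q} {t} d+x≡q+t q<x = ℕ.+-cancelʳ-< x d t (begin-strict
  d + x   ≡⟨ d+x≡q+t ⟩
  q + t   <⟨ ℕ.+-monoˡ-< t q<x ⟩
  x + t   ≡⟨ ℕ.+-comm x t ⟩
  t + x   ∎)
  where open ℕ.≤-Reasoning

separation-bounds : ∀ {n' k d} → d < n' → 2 * suc n' ∸ 2 ≤ k → suc d < suc n' × suc d ≤ k ∸ d
separation-bounds {n'} {k} {d} d<n' 2n'≤k = s≤s d<n' , ℕ.m+n≤o⇒m≤o∸n (suc d) (begin
  suc d + d        ≤⟨ ℕ.+-mono-≤ d<n' (ℕ.<⇒≤ d<n') ⟩
  n' + n'          ≡⟨ cong (n' +_) (sym (ℕ.+-identityʳ n')) ⟩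
  2 * n'           ≡⟨ ℕ.*-distribˡ-∸ 2 (suc n') 1 ⟩
  2 * suc n' ∸ 2   ≤⟨ 2n'≤k ⟩
  k                ∎)
  where open ℕ.≤-Reasoning

lemma3p2 : (n m k : ℕ) (A : Matrix m k) (T : Subset k) →
    2 ≤ n → NConnected n A → 2 * n ∸ 2 ≤ k → ∣ T ∣ ≡ n ∸ 1 →
    NConnected n (splitMatrix A T) →
    (Q : Subset k) → IsCocircuit A Q → Nonempty (Q ∩ T) →
    2 * ∣ Q ∩ T ∣ ≤ ∣ Q ∣
lemma3p2 zero     _ _ _ _ () _ _ _ _ _ _ _
lemma3p2 (suc n') _ k A T _ _ 2n∸2≤k ∣T∣ split-connected Q cocircuit _ with 2 * ∣ Q ∩ T ∣ ≤? ∣ Q ∣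
... | yes enough = enough
... | no  too-much-overlap =
  contradiction (separation (subst (suc ∣ D ∣ ≤_) (sym (∣∁p∣≡n∸∣p∣ D)) room))
                (split-connected (suc ∣ D ∣) (true ∷ D) (s≤s z≤n) order<n)
  where
    open Splitting A T Q cocircuit
    D-small : ∣ D ∣ < n'
    D-small = overlap-shrinks (trans (∣⊕∣+2∣∩∣ Q T) (cong (∣ Q ∣ +_) ∣T∣)) (ℕ.≰⇒> too-much-overlap)
    order<n : suc ∣ D ∣ < suc n'
    order<n = proj₁ (separation-bounds D-small 2n∸2≤k)
    room : suc ∣ D ∣ ≤ k ∸ ∣ D ∣
    room = proj₂ (separation-bounds D-small 2n∸2≤k)
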